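{- For every bivaluation $\rho$ for $LET_K$, the map $v_\rho:For(\Sigma)\to B_{LET_K}$ given by $v_\rho(A)=(\rho(A),\rho(\neg A),\rho(\circ A))$ is a valuation over the Nmatrix $\mathcal{M}_{LET_K}$, and for every formula $A$: $v_\rho(A)\in\mathrm{D}$ if and only if $\rho(A)=1$.
   Context: Fix a denumerable set of propositional variables and let $For(\Sigma)$ be the set of formulas over $\Sigma=\{\land,\lor,\to,\neg,\circ\}$. A bivaluation for $LET_K$ is a function $\rho:For(\Sigma)\to\{0,1\}$ such that for all formulas $A,B$: (v1) $\rho(A\land B)=1$ iff $\rho(A)=1$ and $\rho(B)=1$; (v2) $\rho(A\lor B)=1$ iff $\rho(A)=1$ or $\rho(B)=1$; (v3) $\rho(A\to B)=1$ iff $\rho(A)=0$ or $\rho(B)=1$; (v4) $\rho(\neg\neg A)=1$ iff $\rho(A)=1$; (v5) $\rho(\neg(A\land B))=1$ iff $\rho(\neg A)=1$ or $\rho(\neg B)=1$; (v6) $\rho(\neg(A\lor B))=1$ iff $\rho(\neg A)=1$ and $\rho(\neg B)=1$; (v7) $\rho(\neg(A\to B))=1$ iff $\rho(A)=1$ and $\rho(\neg B)=1$; (v8) if $\rho(\circ A)=1$ then ($\rho(\neg A)=1$ iff $\rho(A)=0$). Let $\{0,1\}$ be the two-element Boolean algebra with $\sqcap,\sqcup,\sim$ and $a\Rightarrow b=\sim a\sqcup b$. An Nmatrix is a triple $(M,\mathrm{D},\mathcal{O})$ with $\emptyset\ne\mathrm{D}\subseteq M$ and $\mathcal{O}(\#):M^n\to\wp(M)\setminus\{\emptyset\}$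 for each $n$-ary connective $\#$; a valuation over it is a map $v$ from formulas to $M$ with $v(\#(A_1,\dots,A_n))\in\mathcal{O}(\#)(v(A_1),\dots,v(A_n))$. The Nmatrix $\mathcal{M}_{LET_K}$ has domain $B_{LET_K}=\{z\in\{0,1\}^3: z_3\le z_1\sqcup z_2,\ z_1\sqcap z_2\sqcap z_3=0\}=\{T=(1,0,1),T_0=(1,0,0),\mathsf{b}=(1,1,0),\mathsf{n}=(0,0,0),F_0=(0,1,0),F=(0,1,1)\}$, designated set $\mathrm{D}=\{z:z_1=1\}=\{T,T_0,\mathsf{b}\}$, and multioperations ($u$ ranging over $B_{LET_K}$): $z\tilde\land w=\{u:u_1=z_1\sqcap w_1,u_2=z_2\sqcup w_2\}$; $z\tilde\lor w=\{u:u_1=z_1\sqcup w_1,u_2=z_2\sqcap w_2\}$; $z\tilde\to w=\{u:u_1=z_1\Rightarrow w_1,u_2=z_1\sqcap w_2\}$; $\tilde\neg z=\{u:u_1=z_2,u_2=z_1\}$; $\tilde\circ z=\{u:u_1=z_3\}$. -}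

module Defs where

open import Data.Nat using (ℕ)
open import Data.Bool using (Bool; true; false; _∧_; _∨_; not; T)
open import Data.Bool.Properties using ()
open import Data.Product using (Σ; _×_; _,_; proj₁; proj₂)
open import Relation.Binary.PropositionalEquality using (_≡_)
open import Data.Sum using (_⊎_)
open import Function.Bundles using (_⇔_)

data For : Set where
  var  : ℕ → For
  _∧'_ : For → For → For
  _∨'_ : For → For → For
  _⇒'_ : For → For → For
  ¬'_  : For → For
  ∘'_  : For → For

-- the two-element Boolean algebra {0,1} is Bool (false = 0, true = 1)
_⇒ᵇ_ : Bool → Bool → Bool
a ⇒ᵇ b = not a ∨ b

_≤ᵇ_ : Bool → Bool → Set
a ≤ᵇ b = T (a ⇒ᵇ b)

record IsBivaluation (ρ : For → Bool) : Set where
  field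
    v1 : ∀ A B → (ρ (A ∧' B) ≡ true) ⇔ (ρ A ≡ true × ρ B ≡ true)
    v2 : ∀ A B → (ρ (A ∨' B) ≡ true) ⇔ (ρ A ≡ true ⊎ ρ B ≡ true)
    v3 : ∀ A B → (ρ (A ⇒' B) ≡ true) ⇔ (ρ A ≡ false ⊎ ρ B ≡ true)
    v4 : ∀ A → (ρ (¬' ¬' A) ≡ true) ⇔ (ρ A ≡ true)
    v5 : ∀ A B → (ρ (¬' (A ∧' B)) ≡ true) ⇔ (ρ (¬' A) ≡ true ⊎ ρ (¬' B) ≡ true)
    v6 : ∀ A B → (ρ (¬' (A ∨' B)) ≡ true) ⇔ (ρ (¬' A) ≡ true × ρ (¬' B) ≡ true)
    v7 : ∀ A B → (ρ (¬' (A ⇒' B)) ≡ true) ⇔ (ρ A ≡ true × ρ (¬' B) ≡ true)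
    v8 : ∀ A → ρ (∘' A) ≡ true → ((ρ (¬' A) ≡ true) ⇔ (ρ A ≡ false))

Triple : Set
Triple = Bool × Bool × Bool

π₁ π₂ π₃ : Triple → Bool
π₁ (a , _ , _) = a
π₂ (_ , b , _) = b
π₃ (_ , _ , c) = c

InB : Triple → Set
InB z = (π₃ z ≤ᵇ (π₁ z ∨ π₂ z)) × ((π₁ z ∧ π₂ z ∧ π₃ z) ≡ false)

B-LETK : Set
B-LETK = Σ Triple InB

c₁ c₂ c₃ : B-LETK → Bool
c₁ z = π₁ (proj₁ z)
c₂ z = π₂ (proj₁ z)
c₃ z = π₃ (proj₁ z)

Designated : B-LETK → Set
Designated z = c₁ z ≡ true

-- multioperations, given as membership predicates (u ∈ op(z,w))
∧̃ : B-LETK → B-LETK → B-LETK → Set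
∧̃ z w u = (c₁ u ≡ (c₁ z ∧ c₁ w)) × (c₂ u ≡ (c₂ z ∨ c₂ w))

∨̃ : B-LETK → B-LETK → B-LETK → Set
∨̃ z w u = (c₁ u ≡ (c₁ z ∨ c₁ w)) × (c₂ u ≡ (c₂ z ∧ c₂ w))

⇒̃ : B-LETK → B-LETK → B-LETK → Set
⇒̃ z w u = (c₁ u ≡ (c₁ z ⇒ᵇ c₁ w)) × (c₂ u ≡ (c₁ z ∧ c₂ w))

¬̃ : B-LETK → B-LETK → Set
¬̃ z u = (c₁ u ≡ c₂ z) × (c₂ u ≡ c₁ z)

∘̃ : B-LETK → B-LETK → Set
∘̃ z u = c₁ u ≡ c₃ z

record IsValuation (v : For → B-LETK) : Set where
  field
    val-∧ : ∀ A B → ∧̃ (v A) (v B) (v (A ∧' B))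
    val-∨ : ∀ A B → ∨̃ (v A) (v B) (v (A ∨' B))
    val-⇒ : ∀ A B → ⇒̃ (v A) (v B) (v (A ⇒' B))
    val-¬ : ∀ A → ¬̃ (v A) (v (¬' A))
    val-∘ : ∀ A → ∘̃ (v A) (v (∘' A))

triple-ρ : (For → Bool) → For → Triple
triple-ρ ρ A = (ρ A , ρ (¬' A) , ρ (∘' A))

{-# OPTIONS --safe #-}
-- Each clause (v1)–(v7) characterises when ρ of a compound formula is 1 by a Boolean
-- condition on the components, so it pins that value down to the Boolean operation
-- prescribed by the multioperation; (v8) excludes exactly the two triples (1,1,1) and
-- (0,0,1) outside B_{LET_K}.
module Submission where

open import Defs
open import Data.Bool using (Bool; true; false; _∧_; _∨_)
open import Data.Product using (Σ; _×_; _,_; proj₁; proj₂)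
open import Data.Sum using (_⊎_; inj₁; inj₂; [_,_])
open import Data.Unit using (tt)
open import Relation.Binary.PropositionalEquality using (_≡_; refl; sym)
open import Function.Base using (id; const)
open import Function.Bundles using (_⇔_; mk⇔; Equivalence)

open Equivalence

≡-via-⇔ : ∀ {x y} {P : Set} → (x ≡ true) ⇔ P → (y ≡ true) ⇔ P → x ≡ y
≡-via-⇔ {true}  {true}  _  _  = refl
≡-via-⇔ {true}  {false} ex ey = sym (from ey (to ex refl))
≡-via-⇔ {false} {true}  ex ey = from ex (to ey refl)
≡-via-⇔ {false} {false} _  _  = refl

∧≡true⇔ : ∀ {a b} → (a ∧ b ≡ true) ⇔ (a ≡ true × b ≡ true)
∧≡true⇔ {true}  {true}  = mk⇔ (const (refl , refl)) (const refl)
∧≡true⇔ {true}  {false} = mk⇔ (λ ()) proj₂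
∧≡true⇔ {false}         = mk⇔ (λ ()) proj₁

∨≡true⇔ : ∀ {a b} → (a ∨ b ≡ true) ⇔ (a ≡ true ⊎ b ≡ true)
∨≡true⇔ {true}          = mk⇔ inj₁ (const refl)
∨≡true⇔ {false} {true}  = mk⇔ inj₂ (const refl)
∨≡true⇔ {false} {false} = mk⇔ inj₁ [ id , id ]

⇒ᵇ≡true⇔ : ∀ {a b} → (a ⇒ᵇ b ≡ true) ⇔ (a ≡ false ⊎ b ≡ true)
⇒ᵇ≡true⇔ {false}         = mk⇔ (const (inj₁ refl)) (const refl)
⇒ᵇ≡true⇔ {true}  {true}  = mk⇔ inj₂ (const refl)
⇒ᵇ≡true⇔ {true}  {false} = mk⇔ (λ ()) [ (λ ()) , id ]

InB-intro : ∀ {a n c} → (c ≡ true → (n ≡ true) ⇔ (a ≡ false)) → InB (a , n , c)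
InB-intro {true}  {true}  {true}  classical with () ← to (classical refl) refl
InB-intro {false} {false} {true}  classical with () ← from (classical refl) refl
InB-intro {true}  {true}  {false} _ = tt , refl
InB-intro {true}  {false} {true}  _ = tt , refl
InB-intro {true}  {false} {false} _ = tt , refl
InB-intro {false} {true}  {true}  _ = tt , refl
InB-intro {false} {true}  {false} _ = tt , refl
InB-intro {false} {false} {false} _ = tt , refl

proposition2p16 : (ρ : For → Bool) → IsBivaluation ρ →
    Σ ((A : For) → InB (triple-ρ ρ A)) λ inB →
    let v : For → B-LETK
        v A = (triple-ρ ρ A , inB A)
    in IsValuation v × ((A : For) → Designated (v A) ⇔ (ρ A ≡ true))
proposition2p16 ρ bv = inB , valuation , λ _ → mk⇔ id id
  where
  open IsBivaluation bv

  inB : (A : For) → InB (triple-ρ ρ A)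
  inB A = InB-intro (v8 A)

  valuation : IsValuation (λ A → triple-ρ ρ A , inB A)
  valuation = record
    { val-∧ = λ A B → ≡-via-⇔ (v1 A B) ∧≡true⇔ , ≡-via-⇔ (v5 A B) ∨≡true⇔
    ; val-∨ = λ A B → ≡-via-⇔ (v2 A B) ∨≡true⇔ , ≡-via-⇔ (v6 A B) ∧≡true⇔
    ; val-⇒ = λ A B → ≡-via-⇔ (v3 A B) ⇒ᵇ≡true⇔ , ≡-via-⇔ (v7 A B) ∧≡true⇔
    ; val-¬ = λ A → refl , ≡-via-⇔ (v4 A) (mk⇔ id id)
    ; val-∘ = λ A → refl
    }
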